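{- Let $k\ge 0$ be an integer, let $n=8k+4$, and let $G$ be a graph of order $n$. If $G$ is Hadamard diagonalizable, then $G$ is one of the four graphs $K_n$, $K_{n/2,n/2}$, $nK_1$, $2K_{n/2}$.
   Context: Graphs are finite and simple. A (real) Hadamard matrix of order $n$ is an $n\times n$ matrix $H$ with entries in $\{1,-1\}$ such that $H^TH=nI$. The Laplacian matrix $L$ of a graph $G$ is defined by $L_{uu}=\deg(u)$, $L_{uv}=-1$ if $u\neq v$ are adjacent, and $L_{uv}=0$ otherwise. $G$ is Hadamard diagonalizable if there is a Hadamard matrix $H$ of order $n=|V(G)|$ such that $\frac1n H^TLH$ is a diagonal matrix (equivalently, $L$ has $n$ mutually orthogonal eigenvectors with all entries in $\{\pm1\}$). $K_n$ is the complete graph, $K_{a,b}$ the complete bipartite graph, $nK_1$ the edgeless graph on $n$ vertices, and $2K_{n/2}$ the disjoint union of two copies of $K_{n/2}$. -}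

module Defs where

open import Data.Nat as ℕ using (ℕ; zero; suc; _<ᵇ_)
open import Data.Integer as ℤ using (ℤ; +_; -_; _*_; _+_)
open import Data.Fin using (Fin; zero; suc; toℕ; _≟_)
open import Data.Bool using (Bool; true; false; if_then_else_; not; _∧_; _∨_)
open import Data.Sum using (_⊎_)
open import Data.Product using (Σ; _×_)
open import Relation.Binary.PropositionalEquality using (_≡_; _≢_)
open import Relation.Nullary.Decidable using (⌊_⌋)
open import Function.Bundles using (_↔_; Inverse)

record Graph (n : ℕ) : Set where
  field
    adj    : Fin n → Fin n → Bool
    sym    : ∀ u v → adj u v ≡ adj v u
    irrefl : ∀ u → adj u u ≡ false
open Graph public

Σᶠ : ∀ {n} → (Fin n → ℤ) → ℤ
Σᶠ {zero}  f = + 0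
Σᶠ {suc n} f = f zero + Σᶠ (λ i → f (suc i))

Matrix : ℕ → Set
Matrix n = Fin n → Fin n → ℤ

_ᵀ : ∀ {n} → Matrix n → Matrix n
(A ᵀ) i j = A j i

_·_ : ∀ {n} → Matrix n → Matrix n → Matrix n
(A · B) i j = Σᶠ (λ l → A i l * B l j)

boolℤ : Bool → ℤ
boolℤ true  = + 1
boolℤ false = + 0

degree : ∀ {n} → Graph n → Fin n → ℤ
degree G u = Σᶠ (λ v → boolℤ (adj G u v))

laplacian : ∀ {n} → Graph n → Matrix n
laplacian G u v = if ⌊ u ≟ v ⌋ then degree G u else - boolℤ (adj G u v)

IsHadamard : ∀ {n} → Matrix n → Set
IsHadamard {n} H =
  (∀ i j → (H i j ≡ + 1) ⊎ (H i j ≡ - (+ 1)))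
  × (∀ i j → ((H ᵀ) · H) i j ≡ (if ⌊ i ≟ j ⌋ then + n else + 0))

IsDiagonal : ∀ {n} → Matrix n → Set
IsDiagonal M = ∀ i j → i ≢ j → M i j ≡ + 0

-- G is Hadamard diagonalizable: some Hadamard H makes (1/n) Hᵀ L H diagonal.
-- Since n ≥ 1 here (the scalar 1/n is nonzero), this is stated as Hᵀ L H diagonal.
HadamardDiagonalizable : ∀ {n} → Graph n → Set
HadamardDiagonalizable G =
  Σ (Matrix _) λ H → IsHadamard H × IsDiagonal ((H ᵀ) · (laplacian G · H))

_≅_ : ∀ {n} → Graph n → Graph n → Set
_≅_ {n} G G' = Σ (Fin n ↔ Fin n) λ f →
  ∀ u v → adj G u v ≡ adj G' (Inverse.to f u) (Inverse.to f v)

half : ∀ {n} → ℕ → Fin n → Bool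
half m i = toℕ i <ᵇ m

diff : ∀ {n} → Fin n → Fin n → Bool
diff u v = not ⌊ u ≟ v ⌋

open import Data.Bool using (_xor_)
open import Data.Bool.Properties using (∧-comm)
open import Relation.Binary.PropositionalEquality using (refl; cong; cong₂)
open import Relation.Nullary using (yes; no)

private
  diff-sym : ∀ {n} (u v : Fin n) → diff u v ≡ diff v u
  diff-sym u v with u ≟ v | v ≟ u
  ... | yes _ | yes _ = refl
  ... | no _  | no _  = refl
  ... | yes p | no q  = Data.Empty.⊥-elim (q (Relation.Binary.PropositionalEquality.sym p))
    where import Data.Empty
  ... | no p  | yes q = Data.Empty.⊥-elim (p (Relation.Binary.PropositionalEquality.sym q))
    where import Data.Empty

  diff-irr : ∀ {n} (u : Fin n) → diff u u ≡ false
  diff-irr u with u ≟ u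
  ... | yes _ = refl
  ... | no p  = Data.Empty.⊥-elim (p refl)
    where import Data.Empty

  xor-comm : ∀ a b → a xor b ≡ b xor a
  xor-comm true true = refl
  xor-comm true false = refl
  xor-comm false true = refl
  xor-comm false false = refl

  xor-self : ∀ a → a xor a ≡ false
  xor-self true = refl
  xor-self false = refl

  same : Bool → Bool → Bool
  same a b = not (a xor b)

complete : (n : ℕ) → Graph n
complete n = record { adj = diff ; sym = diff-sym ; irrefl = diff-irr }

edgeless : (n : ℕ) → Graph n
edgeless n = record { adj = λ _ _ → false ; sym = λ _ _ → refl ; irrefl = λ _ → refl }

completeBipartite : (m : ℕ) → Graph (m ℕ.+ m)
completeBipartite m = record
  { adj = λ u v → half m u xor half m v
  ; sym = λ u v → xor-comm (half m u) (half m v)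
  ; irrefl = λ u → xor-self (half m u) }

twoCliques : (m : ℕ) → Graph (m ℕ.+ m)
twoCliques m = record
  { adj = λ u v → diff u v ∧ same (half m u) (half m v)
  ; sym = λ u v → cong₂ _∧_ (diff-sym u v) (cong not (xor-comm (half m u) (half m v)))
  ; irrefl = λ u → cong (_∧ same (half m u) (half m u)) (diff-irr u) }

{-# OPTIONS --safe #-}
-- Let L be the Laplacian, H the Hadamard matrix and D = Hᵀ L H, which is diagonal. The rows of H
-- are orthogonal as well, so the columns of H are eigenvectors of L and n² L = H D Hᵀ. Computing
-- (H D Hᵀ)_zw once more after inserting the factor H_uj² = 1 gives n L_zw = Σ_v L_uv ⟨u,v,z,w⟩,
-- where ⟨u,v,z,w⟩ sums the entrywise products of four rows of H. For four distinct rows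
-- ⟨u,v,z,w⟩ + n ≡ 0 (mod 8), and the sum is 0 when v repeats one of u, z, w. Since L has zero row
-- sums this gives n (L_zw - L_uu - L_uz - L_uw) ≡ 0 (mod 8) for distinct u, z, w, and for
-- n ≡ 4 (mod 8) the bracket is even: a_zw ≡ a_uz + a_uw + deg u (mod 2). Fixing u, G is thus the
-- Seidel switching of K_n (deg u odd) or of nK₁ (deg u even) with respect to the neighbourhood of u
-- (closed when deg u is odd). Comparing n² L_ww with the trace of D shows that G is regular, which
-- forces the switching set to be empty, everything, or exactly half of the vertices: these are the
-- four graphs.
module Submission where

module HadamardDiagonalizableGraphs where

  open import Defs hiding (sym)
  open import Data.Nat as ℕ using (ℕ; zero; suc; NonZero; _<ᵇ_)
  import Data.Nat.Properties as ℕP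
  open import Data.Integer as ℤ using (ℤ; +_; -_; _+_; _-_; _*_; _≤_; -[1+_])
  open import Data.Integer.Properties
    using (+-identityˡ; +-identityʳ; +-inverseʳ; +-injective; *-zeroʳ; *-identityˡ; *-identityʳ;
           *-comm; *-assoc; *-distribˡ-+; *-distribʳ-+; *-cancelˡ-≡; -1*i≡-i; pos-*;
           i*j≡0⇒i≡0∨j≡0; ≤-refl; ≤-trans; ≤-antisym; +-mono-≤; +-monoʳ-≤; +-monoˡ-≤;
           +-0-abelianGroup; *-semigroup)
  open import Data.Integer.Tactic.RingSolver using (solve-∀)
  open import Algebra.Properties.AbelianGroup +-0-abelianGroup using (identityˡ-unique)
  open import Algebra.Definitions.RawMagma ℤ.*-rawMagma using (_∣_; _,_)
  open import Algebra.Properties.Semigroup.Divisibility *-semigroup using (x∣ʳy⇒x∣ʳzy)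
  open import Data.Fin using (Fin; zero; suc; _≟_; toℕ; fromℕ<; punchIn)
  open import Data.Fin.Properties using (toℕ-fromℕ<; any?)
  open import Data.Fin.Permutation using (lift₀; insert)
  open import Function.Bundles using (_↔_; Inverse; Injection)
  open import Function.Properties.Inverse using (↔⇒↣)
  open import Function.Construct.Identity using (↔-id)
  open import Data.Bool using (Bool; true; false; if_then_else_; not; _xor_; _∧_)
  open import Data.Bool.Properties
    using (not-distribˡ-xor; not-involutive; xor-assoc; xor-comm; xor-same; xor-identityʳ; ¬-not)
    renaming (_≟_ to _≟ᵇ_)
  open import Data.Product using (Σ; _,_; proj₁; proj₂)
  open import Data.Sum using (_⊎_; inj₁; inj₂)
  open import Data.Empty using (⊥-elim)
  open import Relation.Binary.PropositionalEquality
  open import Relation.Nullary using (Dec; yes; no)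
  open import Relation.Nullary.Decidable using (⌊_⌋)

  private
    variable
      n : ℕ

  Σᶠ-cong : {f g : Fin n → ℤ} → (∀ i → f i ≡ g i) → Σᶠ f ≡ Σᶠ g
  Σᶠ-cong {zero}  f≗g = refl
  Σᶠ-cong {suc n} f≗g = cong₂ _+_ (f≗g zero) (Σᶠ-cong (λ i → f≗g (suc i)))

  Σᶠ-distrib-+ : (f g : Fin n → ℤ) → Σᶠ (λ i → f i + g i) ≡ Σᶠ f + Σᶠ g
  Σᶠ-distrib-+ {zero}  f g = refl
  Σᶠ-distrib-+ {suc n} f g = trans
    (cong (_+_ (f zero + g zero)) (Σᶠ-distrib-+ (λ i → f (suc i)) (λ i → g (suc i))))
    (interchange (f zero) (g zero) _ _)
    where
    interchange : ∀ a b c d → (a + b) + (c + d) ≡ (a + c) + (b + d)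
    interchange = solve-∀

  -- n is a module parameter because, as an implicit argument, it is not inferable in chains of _⊕_.
  module Σᶠ-Additivity (n : ℕ) where

    infixl 6 _⊕_
    _⊕_ : {f g : Fin n → ℤ} {a b : ℤ} → Σᶠ f ≡ a → Σᶠ g ≡ b →
          Σᶠ (λ i → f i + g i) ≡ a + b
    _⊕_ {f} {g} Σf≡a Σg≡b = trans (Σᶠ-distrib-+ f g) (cong₂ _+_ Σf≡a Σg≡b)

  *-distribˡ-Σᶠ : (c : ℤ) (f : Fin n → ℤ) → c * Σᶠ f ≡ Σᶠ (λ i → c * f i)
  *-distribˡ-Σᶠ {zero}  c f = *-zeroʳ c
  *-distribˡ-Σᶠ {suc n} c f = trans (*-distribˡ-+ c (f zero) _)
    (cong (_+_ (c * f zero)) (*-distribˡ-Σᶠ c (λ i → f (suc i))))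

  *-distribʳ-Σᶠ : (c : ℤ) (f : Fin n → ℤ) → Σᶠ f * c ≡ Σᶠ (λ i → f i * c)
  *-distribʳ-Σᶠ c f = trans (*-comm (Σᶠ f) c)
    (trans (*-distribˡ-Σᶠ c f) (Σᶠ-cong (λ i → *-comm c (f i))))

  Σᶠ-neg : (f : Fin n → ℤ) → Σᶠ (λ i → - f i) ≡ - Σᶠ f
  Σᶠ-neg f = trans (Σᶠ-cong (λ i → sym (-1*i≡-i (f i))))
    (trans (sym (*-distribˡ-Σᶠ (- (+ 1)) f)) (-1*i≡-i (Σᶠ f)))

  Σᶠ-zero : Σᶠ {n} (λ _ → + 0) ≡ + 0
  Σᶠ-zero {zero}  = refl
  Σᶠ-zero {suc n} = trans (+-identityˡ _) (Σᶠ-zero {n})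

  Σᶠ-const : (c : ℤ) → Σᶠ {n} (λ _ → c) ≡ + n * c
  Σᶠ-const {zero}  c = refl
  Σᶠ-const {suc n} c = trans (cong (_+_ c) (Σᶠ-const {n} c)) (step (+ n) c)
    where
    step : ∀ m c → c + m * c ≡ (+ 1 + m) * c
    step = solve-∀

  Σᶠ-comm : ∀ {m} (f : Fin m → Fin n → ℤ) →
            Σᶠ (λ i → Σᶠ (f i)) ≡ Σᶠ (λ j → Σᶠ (λ i → f i j))
  Σᶠ-comm {n} {zero}  f = sym (Σᶠ-zero {n})
  Σᶠ-comm {n} {suc m} f = trans (cong (_+_ (Σᶠ (f zero))) (Σᶠ-comm (λ i → f (suc i))))
    (sym (Σᶠ-distrib-+ (f zero) (λ j → Σᶠ (λ i → f (suc i) j))))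

  Σᶠ-nonNeg : {f : Fin n → ℤ} → (∀ i → + 0 ≤ f i) → + 0 ≤ Σᶠ f
  Σᶠ-nonNeg {zero}  0≤f = ≤-refl
  Σᶠ-nonNeg {suc n} 0≤f = +-mono-≤ (0≤f zero) (Σᶠ-nonNeg (λ i → 0≤f (suc i)))

  term≤Σᶠ : {f : Fin n → ℤ} → (∀ i → + 0 ≤ f i) → ∀ i → f i ≤ Σᶠ f
  term≤Σᶠ {suc n} {f} 0≤f zero = subst (_≤ Σᶠ f) (+-identityʳ (f zero))
    (+-monoʳ-≤ (f zero) (Σᶠ-nonNeg (λ i → 0≤f (suc i))))
  term≤Σᶠ {suc n} {f} 0≤f (suc i) = ≤-trans (term≤Σᶠ (λ j → 0≤f (suc j)) i)
    (subst (_≤ Σᶠ f) (+-identityˡ _) (+-monoˡ-≤ (Σᶠ (λ j → f (suc j))) (0≤f zero)))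

  Σᶠ≡0⇒≡0 : {f : Fin n → ℤ} → (∀ i → + 0 ≤ f i) → Σᶠ f ≡ + 0 → ∀ i → f i ≡ + 0
  Σᶠ≡0⇒≡0 0≤f Σf≡0 i = ≤-antisym (subst (_ ≤_) Σf≡0 (term≤Σᶠ 0≤f i)) (0≤f i)

  ∣-+ : ∀ {d x y} → d ∣ x → d ∣ y → d ∣ x + y
  ∣-+ {d} (p , refl) (q , refl) = p + q , *-distribʳ-+ d p q

  ∣-Σᶠ : ∀ {d} (f : Fin n → ℤ) → (∀ i → d ∣ f i) → d ∣ Σᶠ f
  ∣-Σᶠ {zero}  f d∣f = + 0 , refl
  ∣-Σᶠ {suc n} f d∣f = ∣-+ (d∣f zero) (∣-Σᶠ (λ i → f (suc i)) (λ i → d∣f (suc i)))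

  δ : Fin n → Fin n → ℤ
  δ i j = boolℤ ⌊ i ≟ j ⌋

  δ-refl : (i : Fin n) → δ i i ≡ + 1
  δ-refl i with i ≟ i
  ... | yes _   = refl
  ... | no  i≢i = ⊥-elim (i≢i refl)

  δ-≢ : {i j : Fin n} → i ≢ j → δ i j ≡ + 0
  δ-≢ {i = i} {j} i≢j with i ≟ j
  ... | yes i≡j = ⊥-elim (i≢j i≡j)
  ... | no  _   = refl

  δ-comm : (i j : Fin n) → δ i j ≡ δ j i
  δ-comm i j with i ≟ j
  ... | yes refl = sym (δ-refl i)
  ... | no  i≢j  = sym (δ-≢ (≢-sym i≢j))

  δ-suc : (i j : Fin n) → δ (suc i) (suc j) ≡ δ i j
  δ-suc i j with i ≟ j
  ... | yes _ = refl
  ... | no  _ = refl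

  Σᶠ-δ : (f : Fin n → ℤ) (i : Fin n) → Σᶠ (λ j → f j * δ i j) ≡ f i
  Σᶠ-δ {suc n} f zero = trans
    (cong₂ _+_ (*-identityʳ (f zero))
               (trans (Σᶠ-cong (λ j → *-zeroʳ (f (suc j)))) (Σᶠ-zero {n})))
    (+-identityʳ (f zero))
  Σᶠ-δ {suc n} f (suc i) = trans
    (cong₂ _+_ (*-zeroʳ (f zero)) (Σᶠ-cong (λ j → cong (f (suc j) *_) (δ-suc i j))))
    (trans (+-identityˡ _) (Σᶠ-δ (λ j → f (suc j)) i))

  IsScalar : ℤ → Matrix n → Set
  IsScalar c A = ∀ i j → A i j ≡ (if ⌊ i ≟ j ⌋ then c else + 0)

  scalar-δ : ∀ {c} {A : Matrix n} → IsScalar c A → ∀ i j → A i j ≡ c * δ i j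
  scalar-δ {c = c} A≡cI i j = trans (A≡cI i j) (if-then-0 ⌊ i ≟ j ⌋)
    where
    if-then-0 : ∀ b → (if b then c else + 0) ≡ c * boolℤ b
    if-then-0 true  = sym (*-identityʳ c)
    if-then-0 false = sym (*-zeroʳ c)

  diagonal-δ : {D : Matrix n} → IsDiagonal D → ∀ i j → D i j ≡ D j j * δ j i
  diagonal-δ {D = D} diagonal i j with i ≟ j
  ... | yes refl = sym (trans (cong (D i i *_) (δ-refl i)) (*-identityʳ (D i i)))
  ... | no  i≢j  = trans (diagonal i j i≢j)
    (sym (trans (cong (D j j *_) (δ-≢ (≢-sym i≢j))) (*-zeroʳ (D j j))))

  ·-congʳ : (A : Matrix n) {B C : Matrix n} → (∀ i j → B i j ≡ C i j) →
            ∀ i j → (A · B) i j ≡ (A · C) i j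
  ·-congʳ A B≡C i j = Σᶠ-cong (λ l → cong (A i l *_) (B≡C l j))

  Σᶠ-· : (A B : Matrix n) (x : Fin n → ℤ) (i : Fin n) →
         Σᶠ (λ j → (A · B) i j * x j) ≡ Σᶠ (λ l → A i l * Σᶠ (λ j → B l j * x j))
  Σᶠ-· A B x i = begin
    Σᶠ (λ j → Σᶠ (λ l → A i l * B l j) * x j)
      ≡⟨ Σᶠ-cong (λ j → *-distribʳ-Σᶠ (x j) (λ l → A i l * B l j)) ⟩
    Σᶠ (λ j → Σᶠ (λ l → A i l * B l j * x j))
      ≡⟨ Σᶠ-comm (λ j l → A i l * B l j * x j) ⟩
    Σᶠ (λ l → Σᶠ (λ j → A i l * B l j * x j))
      ≡⟨ Σᶠ-cong (λ l → Σᶠ-cong (λ j → *-assoc (A i l) (B l j) (x j))) ⟩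
    Σᶠ (λ l → Σᶠ (λ j → A i l * (B l j * x j)))
      ≡⟨ Σᶠ-cong (λ l → *-distribˡ-Σᶠ (A i l) (λ j → B l j * x j)) ⟨
    Σᶠ (λ l → A i l * Σᶠ (λ j → B l j * x j))
      ∎
    where open ≡-Reasoning

  ·-assoc : (A B C : Matrix n) → ∀ i j → ((A · B) · C) i j ≡ (A · (B · C)) i j
  ·-assoc A B C i j = Σᶠ-· A B (λ l → C l j) i

  ·-scalarˡ : ∀ {c} {A : Matrix n} → IsScalar c A → (B : Matrix n) →
              ∀ i j → (A · B) i j ≡ c * B i j
  ·-scalarˡ {c = c} {A} A≡cI B i j = begin
    Σᶠ (λ l → A i l * B l j)
      ≡⟨ Σᶠ-cong (λ l → trans (cong (_* B l j) (scalar-δ A≡cI i l))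
                              (swap₂₃ c (δ i l) (B l j))) ⟩
    Σᶠ (λ l → c * B l j * δ i l)
      ≡⟨ Σᶠ-δ (λ l → c * B l j) i ⟩
    c * B i j
      ∎
    where
    open ≡-Reasoning
    swap₂₃ : ∀ a b c → a * b * c ≡ a * c * b
    swap₂₃ = solve-∀

  ·-scalarʳ : ∀ {c} {A : Matrix n} → IsScalar c A → (B : Matrix n) →
              ∀ i j → (B · A) i j ≡ B i j * c
  ·-scalarʳ {c = c} {A} A≡cI B i j = begin
    Σᶠ (λ l → B i l * A l j)
      ≡⟨ Σᶠ-cong (λ l → trans (cong (B i l *_) (scalar-δ A≡cI l j))
                        (trans (sym (*-assoc (B i l) c (δ l j))) (cong (B i l * c *_) (δ-comm l j)))) ⟩
    Σᶠ (λ l → B i l * c * δ j l)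
      ≡⟨ Σᶠ-δ (λ l → B i l * c) j ⟩
    B i j * c
      ∎
    where open ≡-Reasoning

  ·-diagonalʳ : (A : Matrix n) {D : Matrix n} → IsDiagonal D → ∀ i j → (A · D) i j ≡ A i j * D j j
  ·-diagonalʳ A {D} diagonal i j = begin
    Σᶠ (λ l → A i l * D l j)
      ≡⟨ Σᶠ-cong (λ l → trans (cong (A i l *_) (diagonal-δ diagonal l j))
                              (sym (*-assoc (A i l) (D j j) (δ j l)))) ⟩
    Σᶠ (λ l → A i l * D j j * δ j l)
      ≡⟨ Σᶠ-δ (λ l → A i l * D j j) j ⟩
    A i j * D j j
      ∎
    where open ≡-Reasoning

  ±1 : ℤ → Set
  ±1 a = (a ≡ + 1) ⊎ (a ≡ - (+ 1))

  ±1-square : ∀ {a} → ±1 a → a * a ≡ + 1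
  ±1-square (inj₁ refl) = refl
  ±1-square (inj₂ refl) = refl

  SignVector : (Fin n → ℤ) → Set
  SignVector x = ∀ i → ±1 (x i)

  Σᶠ-sign² : {s : Fin n → ℤ} → SignVector s → (f : Fin n → ℤ) →
             Σᶠ (λ i → s i * s i * f i) ≡ Σᶠ f
  Σᶠ-sign² ±1s f = Σᶠ-cong (λ i → trans (cong (_* f i) (±1-square (±1s i))) (*-identityˡ (f i)))

  square-nonNeg : (a : ℤ) → + 0 ≤ a * a
  square-nonNeg (+ m)    = subst (+ 0 ≤_) (pos-* m m) (ℤ.+≤+ ℕ.z≤n)
  square-nonNeg -[1+ m ] = ℤ.+≤+ ℕ.z≤n

  square≡0⇒≡0 : ∀ {a} → a * a ≡ + 0 → a ≡ + 0
  square≡0⇒≡0 {a} a²≡0 with i*j≡0⇒i≡0∨j≡0 a a²≡0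
  ... | inj₁ a≡0 = a≡0
  ... | inj₂ a≡0 = a≡0

  -- With P = H Hᵀ: P² = n P and P_uu = n, so the squares of the off-diagonal entries of a row of P
  -- sum to 0.
  IsHadamard-ᵀ : {H : Matrix n} → IsHadamard H → IsHadamard (H ᵀ)
  IsHadamard-ᵀ {n} {H} (±1-entries , orthogonal) = (λ i j → ±1-entries j i) , rows-orthogonal
    where
    P : Matrix n
    P = H · (H ᵀ)

    P-sym : ∀ u v → P u v ≡ P v u
    P-sym u v = Σᶠ-cong (λ l → *-comm (H u l) (H v l))

    P-diagonal : ∀ u → P u u ≡ + n
    P-diagonal u = trans (Σᶠ-cong (λ l → ±1-square (±1-entries u l)))
                         (trans (Σᶠ-const {n} (+ 1)) (*-identityʳ (+ n)))

    P²≡nP : ∀ u w → (P · P) u w ≡ + n * P u w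
    P²≡nP u w = begin
      (P · P) u w                          ≡⟨ ·-assoc H (H ᵀ) P u w ⟩
      (H · ((H ᵀ) · P)) u w                ≡⟨ ·-congʳ H (λ l j → sym (·-assoc (H ᵀ) H (H ᵀ) l j)) u w ⟩
      (H · (((H ᵀ) · H) · (H ᵀ))) u w      ≡⟨ ·-congʳ H (·-scalarˡ orthogonal (H ᵀ)) u w ⟩
      Σᶠ (λ l → H u l * (+ n * H w l))     ≡⟨ Σᶠ-cong (λ l → swap₁₂ (H u l) (+ n) (H w l)) ⟩
      Σᶠ (λ l → + n * (H u l * H w l))     ≡⟨ *-distribˡ-Σᶠ (+ n) (λ l → H u l * H w l) ⟨
      + n * P u w                          ∎
      where
      open ≡-Reasoning
      swap₁₂ : ∀ a b c → a * (b * c) ≡ b * (a * c)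
      swap₁₂ = solve-∀

    off-diagonal² : Fin n → Fin n → ℤ
    off-diagonal² u v = if ⌊ u ≟ v ⌋ then + 0 else P u v * P u v

    off-diagonal²-nonNeg : ∀ u v → + 0 ≤ off-diagonal² u v
    off-diagonal²-nonNeg u v with ⌊ u ≟ v ⌋
    ... | true  = ≤-refl
    ... | false = square-nonNeg (P u v)

    Σoff-diagonal²≡0 : ∀ u → Σᶠ (off-diagonal² u) ≡ + 0
    Σoff-diagonal²≡0 u = identityˡ-unique _ (+ n * + n) (begin
      Σᶠ (off-diagonal² u) + + n * + n
        ≡⟨ cong (_+_ (Σᶠ (off-diagonal² u))) (trans (Σᶠ-δ (λ v → P u v * P u v) u)
                                                    (cong₂ _*_ (P-diagonal u) (P-diagonal u))) ⟨
      Σᶠ (off-diagonal² u) + Σᶠ (λ v → P u v * P u v * δ u v)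
        ≡⟨ Σᶠ-distrib-+ (off-diagonal² u) (λ v → P u v * P u v * δ u v) ⟨
      Σᶠ (λ v → off-diagonal² u v + P u v * P u v * δ u v)
        ≡⟨ Σᶠ-cong (λ v → split ⌊ u ≟ v ⌋ (P u v * P u v)) ⟨
      Σᶠ (λ v → P u v * P u v)
        ≡⟨ Σᶠ-cong (λ v → cong (P u v *_) (P-sym u v)) ⟩
      (P · P) u u
        ≡⟨ P²≡nP u u ⟩
      + n * P u u
        ≡⟨ cong (+ n *_) (P-diagonal u) ⟩
      + n * + n
        ∎)
      where
      open ≡-Reasoning
      split : ∀ b x → x ≡ (if b then + 0 else x) + x * boolℤ b
      split true  x = sym (trans (+-identityˡ _) (*-identityʳ x))
      split false x = sym (trans (cong (_+_ x) (*-zeroʳ x)) (+-identityʳ x))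

    rows-orthogonal : IsScalar (+ n) (H · (H ᵀ))
    rows-orthogonal u v with u ≟ v | Σᶠ≡0⇒≡0 (off-diagonal²-nonNeg u) (Σoff-diagonal²≡0 u) v
    ... | yes refl | _      = P-diagonal u
    ... | no  _    | P²uv≡0 = square≡0⇒≡0 P²uv≡0

  inner : (x y : Fin n → ℤ) → ℤ
  inner x y = Σᶠ (λ i → x i * y i)

  inner₄ : (x y z w : Fin n → ℤ) → ℤ
  inner₄ x y z w = Σᶠ (λ i → x i * y i * z i * w i)

  -- The polynomial is ((1+a)(1+b)(1+c)(1+d) + (1-a)(1-b)(1-c)(1-d))/2, and each product is 0 or 16.
  8∣e₀+e₂+e₄ : ∀ {a b c d} → ±1 a → ±1 b → ±1 c → ±1 d →
               + 8 ∣ a * b * c * d + + 1 + a * b + a * c + a * d + b * c + b * d + c * d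
  8∣e₀+e₂+e₄ (inj₁ refl) (inj₁ refl) (inj₁ refl) (inj₁ refl) = + 1 , refl
  8∣e₀+e₂+e₄ (inj₁ refl) (inj₁ refl) (inj₁ refl) (inj₂ refl) = + 0 , refl
  8∣e₀+e₂+e₄ (inj₁ refl) (inj₁ refl) (inj₂ refl) (inj₁ refl) = + 0 , refl
  8∣e₀+e₂+e₄ (inj₁ refl) (inj₁ refl) (inj₂ refl) (inj₂ refl) = + 0 , refl
  8∣e₀+e₂+e₄ (inj₁ refl) (inj₂ refl) (inj₁ refl) (inj₁ refl) = + 0 , refl
  8∣e₀+e₂+e₄ (inj₁ refl) (inj₂ refl) (inj₁ refl) (inj₂ refl) = + 0 , refl
  8∣e₀+e₂+e₄ (inj₁ refl) (inj₂ refl) (inj₂ refl) (inj₁ refl) = + 0 , refl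
  8∣e₀+e₂+e₄ (inj₁ refl) (inj₂ refl) (inj₂ refl) (inj₂ refl) = + 0 , refl
  8∣e₀+e₂+e₄ (inj₂ refl) (inj₁ refl) (inj₁ refl) (inj₁ refl) = + 0 , refl
  8∣e₀+e₂+e₄ (inj₂ refl) (inj₁ refl) (inj₁ refl) (inj₂ refl) = + 0 , refl
  8∣e₀+e₂+e₄ (inj₂ refl) (inj₁ refl) (inj₂ refl) (inj₁ refl) = + 0 , refl
  8∣e₀+e₂+e₄ (inj₂ refl) (inj₁ refl) (inj₂ refl) (inj₂ refl) = + 0 , refl
  8∣e₀+e₂+e₄ (inj₂ refl) (inj₂ refl) (inj₁ refl) (inj₁ refl) = + 0 , refl
  8∣e₀+e₂+e₄ (inj₂ refl) (inj₂ refl) (inj₁ refl) (inj₂ refl) = + 0 , refl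
  8∣e₀+e₂+e₄ (inj₂ refl) (inj₂ refl) (inj₂ refl) (inj₁ refl) = + 0 , refl
  8∣e₀+e₂+e₄ (inj₂ refl) (inj₂ refl) (inj₂ refl) (inj₂ refl) = + 1 , refl

  8∣inner₄+n : {x y z w : Fin n → ℤ} →
               SignVector x → SignVector y → SignVector z → SignVector w →
               inner x y ≡ + 0 → inner x z ≡ + 0 → inner x w ≡ + 0 →
               inner y z ≡ + 0 → inner y w ≡ + 0 → inner z w ≡ + 0 →
               + 8 ∣ inner₄ x y z w + + n
  8∣inner₄+n {n} {x} {y} {z} {w} ±1x ±1y ±1z ±1w x⊥y x⊥z x⊥w y⊥z y⊥w z⊥w =
    subst (+ 8 ∣_) expand (∣-Σᶠ _ (λ i → 8∣e₀+e₂+e₄ (±1x i) (±1y i) (±1z i) (±1w i)))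
    where
    open Σᶠ-Additivity n

    drop-zeros : ∀ a → a + + 0 + + 0 + + 0 + + 0 + + 0 + + 0 ≡ a
    drop-zeros = solve-∀

    expand : Σᶠ (λ i → x i * y i * z i * w i + + 1 + x i * y i + x i * z i + x i * w i
                        + y i * z i + y i * w i + z i * w i)
             ≡ inner₄ x y z w + + n
    expand = trans (refl ⊕ trans (Σᶠ-const {n} (+ 1)) (*-identityʳ (+ n))
                    ⊕ x⊥y ⊕ x⊥z ⊕ x⊥w ⊕ y⊥z ⊕ y⊥w ⊕ z⊥w)
                   (drop-zeros _)

  bit : Bool → ℕ
  bit b = if b then 1 else 0

  odd : ℕ → Bool
  odd zero    = false
  odd (suc m) = not (odd m)

  odd-+ : ∀ m p → odd (m ℕ.+ p) ≡ odd m xor odd p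
  odd-+ zero    p = refl
  odd-+ (suc m) p = trans (cong not (odd-+ m p)) (not-distribˡ-xor (odd m) (odd p))

  odd-bit : ∀ b → odd (bit b) ≡ b
  odd-bit true  = refl
  odd-bit false = refl

  2∣+⇒¬odd : ∀ {m} → + 2 ∣ + m → odd m ≡ false
  2∣+⇒¬odd (+ q , q*2≡m) =
    trans (cong odd (sym (+-injective (trans (pos-* q 2) q*2≡m)))) (odd-*2 q)
    where
    odd-*2 : ∀ q → odd (q ℕ.* 2) ≡ false
    odd-*2 zero    = refl
    odd-*2 (suc q) = trans (not-involutive _) (odd-*2 q)
  2∣+⇒¬odd (-[1+ q ] , ())

  xor≡false⇒≡ : ∀ {x y} → x xor y ≡ false → x ≡ y
  xor≡false⇒≡ {false} {false} _ = refl
  xor≡false⇒≡ {true}  {true}  _ = refl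

  -- Adding 2 (a + d) to the integer turns it into the natural number a + (b + c + d).
  2∣⇒xor-parity : ∀ a b c d → + 2 ∣ - boolℤ a - + d - - boolℤ b - - boolℤ c →
                  a ≡ (b xor c) xor odd d
  2∣⇒xor-parity a b c d 2∣x = xor≡false⇒≡ (begin
    a xor ((b xor c) xor odd d)
      ≡⟨ cong₂ _xor_ (odd-bit a) (cong (_xor odd d) (trans (odd-+ (bit b) (bit c))
                                                           (cong₂ _xor_ (odd-bit b) (odd-bit c)))) ⟨
    odd (bit a) xor (odd (bit b ℕ.+ bit c) xor odd d)
      ≡⟨ trans (odd-+ (bit a) _) (cong (odd (bit a) xor_) (odd-+ (bit b ℕ.+ bit c) d)) ⟨
    odd (bit a ℕ.+ (bit b ℕ.+ bit c ℕ.+ d))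
      ≡⟨ 2∣+⇒¬odd (subst (+ 2 ∣_) shift (∣-+ 2∣x (boolℤ a + + d , refl))) ⟩
    false
      ∎)
    where
    open ≡-Reasoning
    boolℤ≡bit : ∀ b → boolℤ b ≡ + bit b
    boolℤ≡bit true  = refl
    boolℤ≡bit false = refl
    regroup : ∀ a b c d → - a - d - - b - - c + (a + d) * + 2 ≡ a + (b + c + d)
    regroup = solve-∀
    shift : - boolℤ a - + d - - boolℤ b - - boolℤ c + (boolℤ a + + d) * + 2
            ≡ + (bit a ℕ.+ (bit b ℕ.+ bit c ℕ.+ d))
    shift = trans (regroup (boolℤ a) (boolℤ b) (boolℤ c) (+ d))
      (cong₂ (λ p q → p + (q + + d)) (boolℤ≡bit a) (cong₂ _+_ (boolℤ≡bit b) (boolℤ≡bit c)))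

  8∣[4+8k]*x⇒2∣x : ∀ {n} k → n ≡ 4 ℕ.+ 8 ℕ.* k → ∀ x → + 8 ∣ + n * x → + 2 ∣ x
  8∣[4+8k]*x⇒2∣x k refl x (q , q*8≡nx) = q - + k * x , *-cancelˡ-≡ (+ 4) _ _ (begin
    + 4 * ((q - + k * x) * + 2)              ≡⟨ distribute q (+ k) x ⟩
    q * + 8 - + 8 * + k * x                  ≡⟨ cong (_- + 8 * + k * x) q*8≡nx ⟩
    + (4 ℕ.+ 8 ℕ.* k) * x - + 8 * + k * x    ≡⟨ cong (λ m → (+ 4 + m) * x - + 8 * + k * x) (pos-* 8 k) ⟩
    (+ 4 + + 8 * + k) * x - + 8 * + k * x    ≡⟨ cancel (+ k) x ⟩
    + 4 * x                                  ∎)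
    where
    open ≡-Reasoning
    distribute : ∀ q k x → + 4 * ((q - k * x) * + 2) ≡ q * + 8 - + 8 * k * x
    distribute = solve-∀
    cancel : ∀ k x → (+ 4 + + 8 * k) * x - + 8 * k * x ≡ + 4 * x
    cancel = solve-∀

  count : (Fin n → Bool) → ℕ
  count {zero}  f = 0
  count {suc n} f = if f zero then suc (count (λ i → f (suc i))) else count (λ i → f (suc i))

  Σᶠ-boolℤ : (f : Fin n → Bool) → Σᶠ (λ i → boolℤ (f i)) ≡ + count f
  Σᶠ-boolℤ {zero}  f = refl
  Σᶠ-boolℤ {suc n} f with f zero
  ... | true  = cong (_+_ (+ 1)) (Σᶠ-boolℤ (λ i → f (suc i)))
  ... | false = trans (+-identityˡ _) (Σᶠ-boolℤ (λ i → f (suc i)))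

  module _ {n : ℕ} (G : Graph n) where

    degree≡count : ∀ u → degree G u ≡ + count (adj G u)
    degree≡count u = Σᶠ-boolℤ (adj G u)

    laplacian-diagonal : ∀ u → laplacian G u u ≡ degree G u
    laplacian-diagonal u with u ≟ u
    ... | yes _   = refl
    ... | no  u≢u = ⊥-elim (u≢u refl)

    laplacian-off-diagonal : ∀ {u v} → u ≢ v → laplacian G u v ≡ - boolℤ (adj G u v)
    laplacian-off-diagonal {u} {v} u≢v with u ≟ v
    ... | yes u≡v = ⊥-elim (u≢v u≡v)
    ... | no  _   = refl

    laplacian-δ : ∀ u v → laplacian G u v ≡ degree G u * δ u v + - boolℤ (adj G u v)
    laplacian-δ u v with u ≟ v
    ... | yes refl rewrite irrefl G u = sym (trans (+-identityʳ _) (*-identityʳ (degree G u)))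
    ... | no  _    = sym (trans (cong (_+ _) (*-zeroʳ (degree G u))) (+-identityˡ _))

    laplacian-rowSum : ∀ u → Σᶠ (laplacian G u) ≡ + 0
    laplacian-rowSum u = trans (Σᶠ-cong (laplacian-δ u))
      (trans (Σᶠ-δ (λ _ → degree G u) u ⊕ Σᶠ-neg (λ v → boolℤ (adj G u v)))
             (+-inverseʳ (degree G u)))
      where open Σᶠ-Additivity n

  module HadamardDiagonalization {n : ℕ} {{_ : NonZero n}} (G : Graph n) {H : Matrix n}
    (hadamard : IsHadamard H) (diagonal : IsDiagonal ((H ᵀ) · (laplacian G · H))) where

    L M : Matrix n
    L = laplacian G
    M = (H ᵀ) · (L · H)

    rows-orthogonal : IsScalar (+ n) (H · (H ᵀ))
    rows-orthogonal = proj₂ (IsHadamard-ᵀ hadamard)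

    row-±1 : ∀ u → SignVector (H u)
    row-±1 = proj₁ hadamard

    rows-inner≡0 : ∀ {u v} → u ≢ v → inner (H u) (H v) ≡ + 0
    rows-inner≡0 u≢v =
      trans (scalar-δ rows-orthogonal _ _) (trans (cong (+ n *_) (δ-≢ u≢v)) (*-zeroʳ (+ n)))

    eigenvector : ∀ u j → H u j * M j j ≡ + n * (L · H) u j
    eigenvector u j = begin
      H u j * M j j                ≡⟨ ·-diagonalʳ H diagonal u j ⟨
      (H · M) u j                  ≡⟨ ·-assoc H (H ᵀ) (L · H) u j ⟨
      ((H · (H ᵀ)) · (L · H)) u j  ≡⟨ ·-scalarˡ rows-orthogonal (L · H) u j ⟩
      + n * (L · H) u j            ∎
      where open ≡-Reasoning

    spectralSum : Fin n → Fin n → ℤ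
    spectralSum z w = Σᶠ (λ j → H z j * M j j * H w j)

    spectralSum≡n²L : ∀ z w → spectralSum z w ≡ + n * (+ n * L z w)
    spectralSum≡n²L z w = begin
      Σᶠ (λ j → H z j * M j j * H w j)       ≡⟨ Σᶠ-cong (λ j → cong (_* H w j) (eigenvector z j)) ⟩
      Σᶠ (λ j → + n * (L · H) z j * H w j)   ≡⟨ Σᶠ-cong (λ j → *-assoc (+ n) ((L · H) z j) (H w j)) ⟩
      Σᶠ (λ j → + n * ((L · H) z j * H w j)) ≡⟨ *-distribˡ-Σᶠ (+ n) (λ j → (L · H) z j * H w j) ⟨
      + n * ((L · H) · (H ᵀ)) z w            ≡⟨ cong (+ n *_) (·-assoc L H (H ᵀ) z w) ⟩
      + n * (L · (H · (H ᵀ))) z w            ≡⟨ cong (+ n *_) (·-scalarʳ rows-orthogonal L z w) ⟩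
      + n * (L z w * + n)                    ≡⟨ cong (+ n *_) (*-comm (L z w) (+ n)) ⟩
      + n * (+ n * L z w)                    ∎
      where open ≡-Reasoning

    spectralSum-viaRow : ∀ u z w →
      spectralSum z w ≡ + n * Σᶠ (λ v → L u v * inner₄ (H u) (H v) (H z) (H w))
    spectralSum-viaRow u z w = begin
      Σᶠ (λ j → H z j * M j j * H w j)
        ≡⟨ Σᶠ-sign² (row-±1 u) (λ j → H z j * M j j * H w j) ⟨
      Σᶠ (λ j → H u j * H u j * (H z j * M j j * H w j))
        ≡⟨ Σᶠ-cong (λ j → regroup (H u j) (H z j) (M j j) (H w j)) ⟩
      Σᶠ (λ j → H u j * M j j * K j)
        ≡⟨ Σᶠ-cong (λ j → cong (_* K j) (eigenvector u j)) ⟩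
      Σᶠ (λ j → + n * (L · H) u j * K j)
        ≡⟨ Σᶠ-cong (λ j → *-assoc (+ n) ((L · H) u j) (K j)) ⟩
      Σᶠ (λ j → + n * ((L · H) u j * K j))
        ≡⟨ *-distribˡ-Σᶠ (+ n) (λ j → (L · H) u j * K j) ⟨
      + n * Σᶠ (λ j → (L · H) u j * K j)
        ≡⟨ cong (+ n *_) (Σᶠ-· L H K u) ⟩
      + n * Σᶠ (λ v → L u v * Σᶠ (λ j → H v j * K j))
        ≡⟨ cong (+ n *_) (Σᶠ-cong (λ v → cong (L u v *_)
             (Σᶠ-cong (λ j → insert₂ (H u j) (H v j) (H z j) (H w j))))) ⟩
      + n * Σᶠ (λ v → L u v * inner₄ (H u) (H v) (H z) (H w))
        ∎
      where
      open ≡-Reasoning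
      K : Fin n → ℤ
      K j = H u j * H z j * H w j
      regroup : ∀ a b c d → a * a * (b * c * d) ≡ a * c * (a * b * d)
      regroup = solve-∀
      insert₂ : ∀ a b c d → b * (a * c * d) ≡ a * b * c * d
      insert₂ = solve-∀

    spectralSum-diagonal : ∀ w → spectralSum w w ≡ Σᶠ (λ j → M j j)
    spectralSum-diagonal w =
      trans (Σᶠ-cong (λ j → regroup (H w j) (M j j))) (Σᶠ-sign² (row-±1 w) (λ j → M j j))
      where
      regroup : ∀ a m → a * m * a ≡ a * a * m
      regroup = solve-∀

    four-row-identity : ∀ u z w → + n * L z w ≡ Σᶠ (λ v → L u v * inner₄ (H u) (H v) (H z) (H w))
    four-row-identity u z w =
      *-cancelˡ-≡ (+ n) _ _ (trans (sym (spectralSum≡n²L z w)) (spectralSum-viaRow u z w))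

    count-regular : ∀ v w → count (adj G v) ≡ count (adj G w)
    count-regular v w = +-injective (begin
      + count (adj G v)  ≡⟨ degree≡count G v ⟨
      degree G v         ≡⟨ laplacian-diagonal G v ⟨
      L v v              ≡⟨ *-cancelˡ-≡ (+ n) _ _ (*-cancelˡ-≡ (+ n) _ _ same-trace) ⟩
      L w w              ≡⟨ laplacian-diagonal G w ⟩
      degree G w         ≡⟨ degree≡count G w ⟩
      + count (adj G w)  ∎)
      where
      open ≡-Reasoning
      same-trace : + n * (+ n * L v v) ≡ + n * (+ n * L w w)
      same-trace = trans (sym (spectralSum≡n²L v v))
        (trans (spectralSum-diagonal v) (trans (sym (spectralSum-diagonal w)) (spectralSum≡n²L w w)))

    fourRowResidue : Fin n → Fin n → Fin n → Fin n → ℤ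
    fourRowResidue u z w v = inner₄ (H u) (H v) (H z) (H w) + + n - + n * (δ u v + δ z v + δ w v)

    fourRowResidue-weightedSum : ∀ u z w →
      Σᶠ (λ v → L u v * fourRowResidue u z w v) ≡ + n * (L z w - L u u - L u z - L u w)
    fourRowResidue-weightedSum u z w = begin
      Σᶠ (λ v → L u v * fourRowResidue u z w v)
        ≡⟨ Σᶠ-cong (λ v → expand (L u v) (inner₄ (H u) (H v) (H z) (H w)) (+ n)
                                 (δ u v) (δ z v) (δ w v)) ⟩
      Σᶠ (λ v → L u v * inner₄ (H u) (H v) (H z) (H w) + L u v * + n
                  + - (+ n) * (L u v * δ u v + L u v * δ z v + L u v * δ w v))
        ≡⟨ sym (four-row-identity u z w) ⊕ row-sum ⊕ δ-terms ⟩
      + n * L z w + + 0 * + n + - (+ n) * (L u u + L u z + L u w)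
        ≡⟨ collect (+ n) (L z w) (L u u) (L u z) (L u w) ⟩
      + n * (L z w - L u u - L u z - L u w)
        ∎
      where
      open ≡-Reasoning
      open Σᶠ-Additivity n
      expand : ∀ l q m a b c →
               l * (q + m - m * (a + b + c)) ≡ l * q + l * m + - m * (l * a + l * b + l * c)
      expand = solve-∀
      collect : ∀ m x a b c → m * x + + 0 * m + - m * (a + b + c) ≡ m * (x - a - b - c)
      collect = solve-∀
      row-sum : Σᶠ (λ v → L u v * + n) ≡ + 0 * + n
      row-sum = trans (sym (*-distribʳ-Σᶠ (+ n) (L u))) (cong (_* + n) (laplacian-rowSum G u))
      δ-terms : Σᶠ (λ v → - (+ n) * (L u v * δ u v + L u v * δ z v + L u v * δ w v))
                ≡ - (+ n) * (L u u + L u z + L u w)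
      δ-terms = trans
        (sym (*-distribˡ-Σᶠ (- (+ n)) (λ v → L u v * δ u v + L u v * δ z v + L u v * δ w v)))
        (cong (- (+ n) *_) (Σᶠ-δ (L u) u ⊕ Σᶠ-δ (L u) z ⊕ Σᶠ-δ (L u) w))

    fourRowResidue≡0 : ∀ {u z w v} → inner₄ (H u) (H v) (H z) (H w) ≡ + 0 →
                       δ u v + δ z v + δ w v ≡ + 1 → fourRowResidue u z w v ≡ + 0
    fourRowResidue≡0 inner₄≡0 one-hot =
      trans (cong₂ (λ p q → p + + n - + n * q) inner₄≡0 one-hot) (cancel (+ n))
      where
      cancel : ∀ m → + 0 + m - m * + 1 ≡ + 0
      cancel = solve-∀

    8∣fourRowResidue : ∀ {u z w} → u ≢ z → u ≢ w → z ≢ w → ∀ v → + 8 ∣ fourRowResidue u z w v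
    8∣fourRowResidue {u} {z} {w} u≢z u≢w z≢w v = by-cases v (u ≟ v) (z ≟ v) (w ≟ v)
      where
      by-cases : ∀ v → Dec (u ≡ v) → Dec (z ≡ v) → Dec (w ≡ v) → + 8 ∣ fourRowResidue u z w v
      by-cases _ (yes refl) _ _ = + 0 , sym (fourRowResidue≡0
        (trans (Σᶠ-cong (λ j → *-assoc (H u j * H u j) (H z j) (H w j)))
               (trans (Σᶠ-sign² (row-±1 u) _) (rows-inner≡0 z≢w)))
        (cong₂ _+_ (cong₂ _+_ (δ-refl u) (δ-≢ (≢-sym u≢z))) (δ-≢ (≢-sym u≢w))))
      by-cases _ (no u≢v) (yes refl) _ = + 0 , sym (fourRowResidue≡0
        (trans (Σᶠ-cong (λ j → pair-up (H u j) (H z j) (H w j)))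
               (trans (Σᶠ-sign² (row-±1 z) _) (rows-inner≡0 u≢w)))
        (cong₂ _+_ (cong₂ _+_ (δ-≢ u≢v) (δ-refl z)) (δ-≢ (≢-sym z≢w))))
        where
        pair-up : ∀ a b c → a * b * b * c ≡ b * b * (a * c)
        pair-up = solve-∀
      by-cases _ (no u≢v) (no z≢v) (yes refl) = + 0 , sym (fourRowResidue≡0
        (trans (Σᶠ-cong (λ j → pair-up (H u j) (H w j) (H z j)))
               (trans (Σᶠ-sign² (row-±1 w) _) (rows-inner≡0 u≢z)))
        (cong₂ _+_ (cong₂ _+_ (δ-≢ u≢v) (δ-≢ z≢v)) (δ-refl w)))
        where
        pair-up : ∀ a b c → a * b * c * b ≡ b * b * (a * c)
        pair-up = solve-∀
      by-cases v (no u≢v) (no z≢v) (no w≢v) = subst (+ 8 ∣_) no-correction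
        (8∣inner₄+n (row-±1 u) (row-±1 v) (row-±1 z) (row-±1 w)
                    (rows-inner≡0 u≢v) (rows-inner≡0 u≢z) (rows-inner≡0 u≢w)
                    (rows-inner≡0 (≢-sym z≢v)) (rows-inner≡0 (≢-sym w≢v)) (rows-inner≡0 z≢w))
        where
        drop-zero : ∀ a m → a - m * + 0 ≡ a
        drop-zero = solve-∀
        no-correction : inner₄ (H u) (H v) (H z) (H w) + + n ≡ fourRowResidue u z w v
        no-correction = sym (trans
          (cong (λ q → inner₄ (H u) (H v) (H z) (H w) + + n - + n * q)
                (cong₂ _+_ (cong₂ _+_ (δ-≢ u≢v) (δ-≢ z≢v)) (δ-≢ w≢v)))
          (drop-zero (inner₄ (H u) (H v) (H z) (H w) + + n) (+ n)))

    four-vertex-congruence : ∀ {u z w} → u ≢ z → u ≢ w → z ≢ w →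
                             + 8 ∣ + n * (L z w - L u u - L u z - L u w)
    four-vertex-congruence {u} {z} {w} u≢z u≢w z≢w =
      subst (+ 8 ∣_) (fourRowResidue-weightedSum u z w)
        (∣-Σᶠ _ (λ v → x∣ʳy⇒x∣ʳzy (L u v) (8∣fourRowResidue u≢z u≢w z≢w v)))

    adjacency-parity : ∀ k → n ≡ 4 ℕ.+ 8 ℕ.* k → ∀ {u z w} → u ≢ z → u ≢ w → z ≢ w →
                       adj G z w ≡ (adj G u z xor adj G u w) xor odd (count (adj G u))
    adjacency-parity k n≡4+8k {u} {z} {w} u≢z u≢w z≢w = 2∣⇒xor-parity _ _ _ _
      (8∣[4+8k]*x⇒2∣x k n≡4+8k _
        (subst (λ x → + 8 ∣ + n * x) laplacian-entries (four-vertex-congruence u≢z u≢w z≢w)))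
      where
      laplacian-entries : L z w - L u u - L u z - L u w ≡
        - boolℤ (adj G z w) - + count (adj G u) - - boolℤ (adj G u z) - - boolℤ (adj G u w)
      laplacian-entries =
        cong₂ _-_ (cong₂ _-_ (cong₂ _-_ (laplacian-off-diagonal G z≢w)
                                        (trans (laplacian-diagonal G u) (degree≡count G u)))
                             (laplacian-off-diagonal G u≢z))
                  (laplacian-off-diagonal G u≢w)

  neighbourhood : (G : Graph n) → Fin n → Bool → Fin n → Bool
  neighbourhood G r o v = if ⌊ r ≟ v ⌋ then o else adj G r v

  neighbourhood-centre : (G : Graph n) (r : Fin n) (o : Bool) → neighbourhood G r o r ≡ o
  neighbourhood-centre G r o with r ≟ r
  ... | yes _   = refl
  ... | no  r≢r = ⊥-elim (r≢r refl)

  neighbourhood-≢ : (G : Graph n) {r v : Fin n} (o : Bool) → r ≢ v → neighbourhood G r o v ≡ adj G r v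
  neighbourhood-≢ G {r} {v} o r≢v with r ≟ v
  ... | yes r≡v = ⊥-elim (r≢v r≡v)
  ... | no  _   = refl

  xor-cancelʳ : ∀ x y → (x xor y) xor y ≡ x
  xor-cancelʳ x y = trans (xor-assoc x y y) (trans (cong (x xor_) (xor-same y)) (xor-identityʳ x))

  neighbourhood-switching : (G : Graph n) (r : Fin n) (o : Bool) →
    (∀ {z w} → r ≢ z → r ≢ w → z ≢ w → adj G z w ≡ (adj G r z xor adj G r w) xor o) →
    ∀ {v w} → v ≢ w → adj G v w ≡ (neighbourhood G r o v xor neighbourhood G r o w) xor o
  neighbourhood-switching G r o parity {v} {w} v≢w = by-cases v w v≢w (r ≟ v) (r ≟ w)
    where
    ℓ : Fin _ → Bool
    ℓ = neighbourhood G r o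
    by-cases : ∀ v w → v ≢ w → Dec (r ≡ v) → Dec (r ≡ w) → adj G v w ≡ (ℓ v xor ℓ w) xor o
    by-cases _ _ v≢w (yes refl) (yes refl) = ⊥-elim (v≢w refl)
    by-cases _ w _ (yes refl) (no r≢w) = sym (begin
      (ℓ r xor ℓ w) xor o        ≡⟨ cong₂ (λ x y → (x xor y) xor o) (neighbourhood-centre G r o)
                                                                      (neighbourhood-≢ G o r≢w) ⟩
      (o xor adj G r w) xor o    ≡⟨ cong (_xor o) (xor-comm o (adj G r w)) ⟩
      (adj G r w xor o) xor o    ≡⟨ xor-cancelʳ (adj G r w) o ⟩
      adj G r w                  ∎)
      where open ≡-Reasoning
    by-cases v _ _ (no r≢v) (yes refl) = sym (begin
      (ℓ v xor ℓ r) xor o        ≡⟨ cong₂ (λ x y → (x xor y) xor o) (neighbourhood-≢ G o r≢v)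
                                                                      (neighbourhood-centre G r o) ⟩
      (adj G r v xor o) xor o    ≡⟨ xor-cancelʳ (adj G r v) o ⟩
      adj G r v                  ≡⟨ Graph.sym G r v ⟩
      adj G v r                  ∎)
      where open ≡-Reasoning
    by-cases _ _ v≢w (no r≢v) (no r≢w) = trans (parity r≢v r≢w v≢w)
      (sym (cong₂ (λ x y → (x xor y) xor o) (neighbourhood-≢ G o r≢v) (neighbourhood-≢ G o r≢w)))

  count-cong : {f g : Fin n → Bool} → (∀ i → f i ≡ g i) → count f ≡ count g
  count-cong {zero}  f≗g = refl
  count-cong {suc n} {f} {g} f≗g rewrite f≗g zero with g zero
  ... | true  = cong suc (count-cong (λ i → f≗g (suc i)))
  ... | false = count-cong (λ i → f≗g (suc i))

  count-≤ : (f : Fin n → Bool) → count f ℕ.≤ n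
  count-≤ {zero}  f = ℕ.z≤n
  count-≤ {suc n} f with f zero
  ... | true  = ℕ.s≤s (count-≤ (λ i → f (suc i)))
  ... | false = ℕP.m≤n⇒m≤1+n (count-≤ (λ i → f (suc i)))

  count-not : (f : Fin n → Bool) → count (λ i → not (f i)) ℕ.+ count f ≡ n
  count-not {zero}  f = refl
  count-not {suc n} f with f zero
  ... | true  = trans (ℕP.+-suc _ _) (cong suc (count-not (λ i → f (suc i))))
  ... | false = cong suc (count-not (λ i → f (suc i)))

  diff-suc : (v w : Fin n) → diff (suc v) (suc w) ≡ diff v w
  diff-suc v w with v ≟ w
  ... | yes _ = refl
  ... | no  _ = refl

  count-remove : (f : Fin n → Bool) (v : Fin n) → f v ≡ true →
                 suc (count (λ w → diff v w ∧ f w)) ≡ count f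
  count-remove {suc n} f zero    fv≡true rewrite fv≡true = refl
  count-remove {suc n} f (suc v) fv≡true
    with f zero | trans (cong suc (count-cong (λ w → cong (_∧ f (suc w)) (diff-suc v w))))
                        (count-remove (λ w → f (suc w)) v fv≡true)
  ... | true  | removed = cong suc removed
  ... | false | removed = removed

  double-injective : ∀ {a m} → a ℕ.+ a ≡ m ℕ.+ m → a ≡ m
  double-injective {a} {m} a+a≡m+m =
    ℕP.*-cancelˡ-≡ a m 2 (trans (double a) (trans a+a≡m+m (sym (double m))))
    where
    double : ∀ x → 2 ℕ.* x ≡ x ℕ.+ x
    double x = cong (x ℕ.+_) (ℕP.+-identityʳ x)

  punchIn-<ᵇ : (j : Fin (suc n)) (x : Fin n) → (toℕ (punchIn j x) <ᵇ toℕ j) ≡ (toℕ x <ᵇ toℕ j)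
  punchIn-<ᵇ zero    x       = refl
  punchIn-<ᵇ (suc j) zero    = refl
  punchIn-<ᵇ (suc j) (suc x) = punchIn-<ᵇ j x

  <ᵇ-irrefl : ∀ t → (t <ᵇ t) ≡ false
  <ᵇ-irrefl zero    = refl
  <ᵇ-irrefl (suc t) = <ᵇ-irrefl t

  -- Inductively: vertex 0 goes first if f 0 holds, and otherwise right after the remaining vertices
  -- where f holds.
  sorting-permutation : (f : Fin n → Bool) →
                        Σ (Fin n ↔ Fin n) λ σ → ∀ u → (toℕ (Inverse.to σ u) <ᵇ count f) ≡ f u
  sorting-permutation {zero}  f = ↔-id _ , λ ()
  sorting-permutation {suc n} f with sorting-permutation (λ i → f (suc i)) | f zero in f0
  ... | σ , sorted | true  = lift₀ σ , λ { zero → sym f0 ; (suc u) → sorted u }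
  ... | σ , sorted | false = insert zero j σ , λ
    { zero    → trans (cong (_<ᵇ c) j≡c) (trans (<ᵇ-irrefl c) (sym f0))
    ; (suc u) → trans (subst (λ t → (toℕ (punchIn j (σ′ u)) <ᵇ t) ≡ (toℕ (σ′ u) <ᵇ t))
                             j≡c (punchIn-<ᵇ j (σ′ u)))
                      (sorted u) }
    where
    σ′ : Fin n → Fin n
    σ′ = Inverse.to σ
    c : ℕ
    c = count (λ i → f (suc i))
    j : Fin (suc n)
    j = fromℕ< (ℕ.s≤s (count-≤ (λ i → f (suc i))))
    j≡c : toℕ j ≡ c
    j≡c = toℕ-fromℕ< _

  diff-refl : (v : Fin n) → diff v v ≡ false
  diff-refl v with v ≟ v
  ... | yes _   = refl
  ... | no  v≢v = ⊥-elim (v≢v refl)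

  diff-≢ : {v w : Fin n} → v ≢ w → diff v w ≡ true
  diff-≢ {v = v} {w} v≢w with v ≟ w
  ... | yes v≡w = ⊥-elim (v≢w v≡w)
  ... | no  _   = refl

  diff-↔ : (σ : Fin n ↔ Fin n) (v w : Fin n) → diff (Inverse.to σ v) (Inverse.to σ w) ≡ diff v w
  diff-↔ σ v w with v ≟ w
  ... | yes refl = diff-refl (Inverse.to σ v)
  ... | no  v≢w  = diff-≢ (λ σv≡σw → v≢w (Injection.injective (↔⇒↣ σ) σv≡σw))

  adj-from-off-diagonal : (G : Graph n) (F : Fin n → Fin n → Bool) → (∀ v → F v v ≡ false) →
                          (∀ {v w} → v ≢ w → adj G v w ≡ F v w) → ∀ v w → adj G v w ≡ F v w
  adj-from-off-diagonal G F F-irrefl off-diagonal v w with v ≟ w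
  ... | yes refl = trans (irrefl G v) (sym (F-irrefl v))
  ... | no  v≢w  = off-diagonal v≢w

  OneOfFour : (m : ℕ) → Graph (m ℕ.+ m) → Set
  OneOfFour m G = (G ≅ complete (m ℕ.+ m)) ⊎ (G ≅ completeBipartite m)
                ⊎ (G ≅ edgeless (m ℕ.+ m)) ⊎ (G ≅ twoCliques m)

  module Classification {m : ℕ} (G : Graph (m ℕ.+ m)) (ℓ : Fin (m ℕ.+ m) → Bool)
    (regular : ∀ v w → count (adj G v) ≡ count (adj G w)) where

    -- G is the Seidel switching of K_{m+m} (o = true) or of its complement (o = false) with respect
    -- to the vertex set where ℓ holds.
    SeidelSwitched : Bool → Set
    SeidelSwitched o = ∀ {v w} → v ≢ w → adj G v w ≡ (ℓ v xor ℓ w) xor o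

    halves : count (λ i → not (ℓ i)) ≡ count ℓ →
             Σ (Fin (m ℕ.+ m) ↔ Fin (m ℕ.+ m)) λ σ → ∀ u → half m (Inverse.to σ u) ≡ ℓ u
    halves balanced = σ , λ u → trans (cong (toℕ (Inverse.to σ u) <ᵇ_) (sym count≡m)) (sorted u)
      where
      count≡m : count ℓ ≡ m
      count≡m = double-injective (trans (cong (ℕ._+ count ℓ) (sym balanced)) (count-not ℓ))
      σ : Fin (m ℕ.+ m) ↔ Fin (m ℕ.+ m)
      σ = proj₁ (sorting-permutation ℓ)
      sorted : ∀ u → (toℕ (Inverse.to σ u) <ᵇ count ℓ) ≡ ℓ u
      sorted = proj₂ (sorting-permutation ℓ)

    constant-labelling : (∀ v w → ℓ v xor ℓ w ≡ false) → ∀ o → SeidelSwitched o → OneOfFour m G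
    constant-labelling constant true switched = inj₁ (↔-id _ ,
      adj-from-off-diagonal G diff diff-refl
        (λ v≢w → trans (switched v≢w) (trans (cong (_xor true) (constant _ _)) (sym (diff-≢ v≢w)))))
    constant-labelling constant false switched = inj₂ (inj₂ (inj₁ (↔-id _ ,
      adj-from-off-diagonal G (λ _ _ → false) (λ _ → refl)
        (λ v≢w → trans (switched v≢w) (cong (_xor false) (constant _ _))))))

    bipartite : ∀ {v₁ v₀} → ℓ v₁ ≡ true → ℓ v₀ ≡ false → SeidelSwitched false →
                G ≅ completeBipartite m
    bipartite {v₁} {v₀} ℓv₁ ℓv₀ switched =
      σ , λ u v → trans (adj-eq u v) (cong₂ _xor_ (sym (half-σ u)) (sym (half-σ v)))
      where
      adj-eq : ∀ v w → adj G v w ≡ ℓ v xor ℓ w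
      adj-eq = adj-from-off-diagonal G _ (λ v → xor-same (ℓ v))
        (λ v≢w → trans (switched v≢w) (xor-identityʳ _))
      degree-eq : ∀ v → count (adj G v) ≡ count (λ w → ℓ v xor ℓ w)
      degree-eq v = count-cong (adj-eq v)
      balanced : count (λ i → not (ℓ i)) ≡ count ℓ
      balanced = begin
        count (λ w → not (ℓ w))     ≡⟨ count-cong (λ w → cong (_xor ℓ w) (sym ℓv₁)) ⟩
        count (λ w → ℓ v₁ xor ℓ w)  ≡⟨ trans (sym (degree-eq v₁)) (trans (regular v₁ v₀) (degree-eq v₀)) ⟩
        count (λ w → ℓ v₀ xor ℓ w)  ≡⟨ count-cong (λ w → cong (_xor ℓ w) ℓv₀) ⟩
        count ℓ                     ∎
        where open ≡-Reasoning
      σ : Fin (m ℕ.+ m) ↔ Fin (m ℕ.+ m)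
      σ = proj₁ (halves balanced)
      half-σ : ∀ u → half m (Inverse.to σ u) ≡ ℓ u
      half-σ = proj₂ (halves balanced)

    two-cliques : ∀ {v₁ v₀} → ℓ v₁ ≡ true → ℓ v₀ ≡ false → SeidelSwitched true → G ≅ twoCliques m
    two-cliques {v₁} {v₀} ℓv₁ ℓv₀ switched = σ , λ u v → trans (adj-eq u v)
      (cong₂ _∧_ (sym (diff-↔ σ u v)) (cong not (cong₂ _xor_ (sym (half-σ u)) (sym (half-σ v)))))
      where
      xor-true : ∀ x → x xor true ≡ not x
      xor-true true  = refl
      xor-true false = refl
      adj-eq : ∀ v w → adj G v w ≡ diff v w ∧ not (ℓ v xor ℓ w)
      adj-eq = adj-from-off-diagonal G _ (λ v → cong (_∧ _) (diff-refl v))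
        (λ v≢w → trans (switched v≢w) (trans (xor-true _) (sym (cong (_∧ _) (diff-≢ v≢w)))))
      degree-eq : ∀ v → suc (count (adj G v)) ≡ count (λ w → not (ℓ v xor ℓ w))
      degree-eq v = trans (cong suc (count-cong (adj-eq v)))
                          (count-remove (λ w → not (ℓ v xor ℓ w)) v (cong not (xor-same (ℓ v))))
      balanced : count (λ i → not (ℓ i)) ≡ count ℓ
      balanced = begin
        count (λ w → not (ℓ w))
          ≡⟨ count-cong (λ w → cong (λ x → not (x xor ℓ w)) (sym ℓv₀)) ⟩
        count (λ w → not (ℓ v₀ xor ℓ w))
          ≡⟨ trans (sym (degree-eq v₀)) (trans (cong suc (regular v₀ v₁)) (degree-eq v₁)) ⟩
        count (λ w → not (ℓ v₁ xor ℓ w))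
          ≡⟨ count-cong (λ w → trans (cong (λ x → not (x xor ℓ w)) ℓv₁) (not-involutive (ℓ w))) ⟩
        count ℓ
          ∎
        where open ≡-Reasoning
      σ : Fin (m ℕ.+ m) ↔ Fin (m ℕ.+ m)
      σ = proj₁ (halves balanced)
      half-σ : ∀ u → half m (Inverse.to σ u) ≡ ℓ u
      half-σ = proj₂ (halves balanced)

    non-constant-labelling : ∀ {v₁ v₀} → ℓ v₁ ≡ true → ℓ v₀ ≡ false →
                             ∀ o → SeidelSwitched o → OneOfFour m G
    non-constant-labelling ℓv₁ ℓv₀ true  switched = inj₂ (inj₂ (inj₂ (two-cliques ℓv₁ ℓv₀ switched)))
    non-constant-labelling ℓv₁ ℓv₀ false switched = inj₂ (inj₁ (bipartite ℓv₁ ℓv₀ switched))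

    classify : ∀ o → SeidelSwitched o → OneOfFour m G
    classify o switched with any? (λ v → ℓ v ≟ᵇ true) | any? (λ v → ℓ v ≟ᵇ false)
    ... | yes (_ , ℓv₁) | yes (_ , ℓv₀) = non-constant-labelling ℓv₁ ℓv₀ o switched
    ... | no ¬true | _ =
      constant-labelling (λ v w → cong₂ _xor_ (all-false v) (all-false w)) o switched
      where
      all-false : ∀ v → ℓ v ≡ false
      all-false v = ¬-not (λ ℓv≡true → ¬true (v , ℓv≡true))
    ... | _ | no ¬false =
      constant-labelling (λ v w → cong₂ _xor_ (all-true v) (all-true w)) o switched
      where
      all-true : ∀ v → ℓ v ≡ true
      all-true v = ¬-not (λ ℓv≡false → ¬false (v , ℓv≡false))

open import Data.Nat using (ℕ; _+_; _*_; NonZero)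
open import Data.Nat.Tactic.RingSolver using (solve-∀)
open import Data.Sum using (_⊎_)
open import Data.Fin using (Fin; zero)
open import Data.Bool using (Bool)
open import Data.Product using (_,_)
open import Relation.Binary.PropositionalEquality using (_≡_; subst; sym)
open import Defs
  using (Graph; adj; HadamardDiagonalizable; _≅_; complete; completeBipartite; edgeless; twoCliques)
open HadamardDiagonalizableGraphs

mainTheorem2 : (k : ℕ) (G : Graph ((4 * k + 2) + (4 * k + 2))) →
    HadamardDiagonalizable G →
    (G ≅ complete ((4 * k + 2) + (4 * k + 2)))
    ⊎ (G ≅ completeBipartite (4 * k + 2))
    ⊎ (G ≅ edgeless ((4 * k + 2) + (4 * k + 2)))
    ⊎ (G ≅ twoCliques (4 * k + 2))
mainTheorem2 k G (H , hadamard , diagonal) =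
  classify o (neighbourhood-switching G r o (adjacency-parity k (order k)))
  where
  order : ∀ k → (4 * k + 2) + (4 * k + 2) ≡ 4 + 8 * k
  order = solve-∀
  nonZero : NonZero ((4 * k + 2) + (4 * k + 2))
  nonZero = subst NonZero (sym (order k)) _
  open HadamardDiagonalization {{nonZero}} G hadamard diagonal using (count-regular; adjacency-parity)
  r : Fin ((4 * k + 2) + (4 * k + 2))
  r = subst Fin (sym (order k)) zero
  o : Bool
  o = odd (count (adj G r))
  open Classification {4 * k + 2} G (neighbourhood G r o) count-regular
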